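{- The following two statements are equivalent: (A) For every finite LCM-closed set $\mathcal{N}\subseteq\mathbb{N}^+$ that contains at least one element different from $1$, there exists an integer $d>1$ such that $\#\{n\in\mathcal{N} : d\mid n\}\ge \tfrac12\#\mathcal{N}$. (B) (Union-closed sets conjecture) For every finite union-closed family $\mathcal{S}$ of finite sets having at least one nonempty member, there exists an element $x\in\bigcup\mathcal{S}$ such that $\#\{A\in\mathcal{S}: x\in A\}\ge\tfrac12\#\mathcal{S}$.
   Context: $\mathbb{N}^+=\{1,2,3,\dots\}$. A nonempty set $\mathcal{N}\subseteq\mathbb{N}^+$ is LCM-closed if $m,n\in\mathcal{N}$ implies $\mathrm{lcm}(m,n)\in\mathcal{N}$. A family $\mathcal{S}$ of sets is union-closed if $A,B\in\mathcal{S}$ implies $A\cup B\in\mathcal{S}$. -}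

module Defs where

open import Data.Nat using (ℕ; _*_; _≤_; _<_)
open import Data.Nat.Divisibility using (_∣_; _∣?_)
open import Data.Nat.LCM using (lcm)
open import Data.Fin using (Fin)
open import Data.Fin.Subset as Sub using (Subset; _∪_)
open import Data.Fin.Subset.Properties using (_∈?_)
open import Data.List using (List; length; filter)
open import Data.List.Membership.Propositional using (_∈_)
open import Data.List.Relation.Unary.Unique.Propositional using (Unique)
open import Data.List.Relation.Unary.All using (All)
open import Data.Product using (Σ; ∃; _×_; _,_)
open import Relation.Binary.PropositionalEquality using (_≢_)
open import Function.Bundles using (_⇔_)

-- Statement (A): finite subsets of ℕ⁺ are duplicate-free lists of
-- positive naturals; their cardinality is the list length.

LCMClosed : List ℕ → Set
LCMClosed N = ∀ {m n} → m ∈ N → n ∈ N → lcm m n ∈ N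

countDiv : ℕ → List ℕ → ℕ
countDiv d N = length (filter (d ∣?_) N)

StatementA : Set
StatementA =
  (N : List ℕ) → Unique N → All (λ n → 1 ≤ n) N →
  LCMClosed N → (∃ λ n → n ∈ N × n ≢ 1) →
  ∃ λ d → 1 < d × length N ≤ 2 * countDiv d N

-- Statement (B): a finite family of finite sets is a duplicate-free
-- list of subsets of a finite ground set Fin n (n arbitrary).

UnionClosed : ∀ {n} → List (Subset n) → Set
UnionClosed S = ∀ {A B} → A ∈ S → B ∈ S → (A ∪ B) ∈ S

InUnion : ∀ {n} → Fin n → List (Subset n) → Set
InUnion x S = ∃ λ A → A ∈ S × x Sub.∈ A

countMem : ∀ {n} → Fin n → List (Subset n) → ℕ
countMem x S = length (filter (x ∈?_) S)

StatementB : Set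
StatementB =
  (n : ℕ) (S : List (Subset n)) → Unique S → UnionClosed S →
  (∃ λ A → A ∈ S × Sub.Nonempty A) →
  ∃ λ x → InUnion x S × length S ≤ 2 * countMem x S

module Submission where

-- Both statements are about finite lattices of "joins": lcm on numbers,
-- union on sets.  Each direction is proved by an explicit encoding that
-- turns joins into joins, is injective on the family, and reflects the
-- counted property, so that a frequent divisor (resp. element) for the
-- encoded family yields a frequent element (resp. divisor) for the
-- original one.
--
-- (A) ⇒ (B).  Fix n distinct primes p₀ … pₙ₋₁ (Euclid's construction) and
--   send A ⊆ Fin n to the squarefree number ∏_{i∈A} pᵢ.  Then
--   lcm ↔ ∪, and any d > 1 has a prime factor pᵢ with d ∣ code B ⇒ i ∈ B.
-- (B) ⇒ (A).  Call q an N-prime if q > 1 and q ∣ lcm x y ⇒ q ∣ x ∨ q ∣ y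
--   for x, y ∈ N.  Send m to the set of N-primes q ≤ ΣN dividing m.  Then
--   lcm ↔ ∪ by the N-prime property, and the encoding is injective on N
--   because prime powers are N-primes and divisibility a ∣ b is detected
--   by the prime powers dividing a.

open import Defs
open import Function.Bundles using (_⇔_; mk⇔)
open import Function using (_∘_)
open import Data.Nat using (ℕ; zero; suc; _+_; _*_; _^_; _≤_; _<_; z≤n; s≤s; NonZero; >-nonZero; nonTrivial⇒n>1; _<?_)
open import Data.Nat.Properties
open import Data.Nat.Divisibility
open import Data.Nat.LCM using (lcm; lcm-least; m∣lcm[m,n]; n∣lcm[m,n])
open import Data.Nat.Primality using (Prime; prime⇒nonZero; prime⇒nonTrivial; prime⇒irreducible; euclidsLemma)
open import Data.Nat.Primality.Factorisation using (factorise; PrimeFactorisation)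
open import Data.Nat.ListAction using (sum; product)
open import Data.Bool using (true; false)
open import Data.Unit using (⊤; tt)
open import Data.Vec using (Vec; []; _∷_; lookup; tabulate; here; there)
open import Data.Vec.Properties using (lookup∘tabulate; []=⇒lookup; lookup⇒[]=)
open import Data.Fin using (Fin; zero; suc; toℕ; fromℕ<)
open import Data.Fin.Properties using (toℕ-fromℕ<)
open import Data.Fin.Subset as Sub using (Subset; _∪_; _⊆_)
open import Data.Fin.Subset.Properties using (_∈?_; drop-∷-⊆; ⊆-antisym; ⊆-reflexive; p⊆p∪q; q⊆p∪q; x∈p∪q⁻; x∈p∪q⁺)
open import Data.List using (List; []; _∷_; length; filter; map)
open import Data.List.Properties using (length-map)
open import Data.List.Membership.Propositional using (_∈_)
open import Data.List.Membership.Propositional.Properties using (∈-map⁺; ∈-map⁻; ∈-filter⁻)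
open import Data.List.Relation.Unary.Any using (here; there)
open import Data.List.Relation.Unary.All as All using (All; []; _∷_; all?)
open import Data.List.Relation.Unary.AllPairs using ([]; _∷_)
open import Data.List.Relation.Unary.Unique.Propositional using (Unique)
open import Data.List.Relation.Unary.All.Properties as All using ()
open import Data.List.Relation.Unary.Unique.Propositional.Properties as Unique using ()
open import Data.Product using (Σ; ∃; ∃₂; _×_; _,_; proj₁; proj₂)
open import Data.Sum using (_⊎_; inj₁; inj₂)
open import Relation.Nullary using (¬_; yes; no; does; contradiction)
open import Relation.Nullary.Decidable using (_×-dec_; _⊎-dec_; _→-dec_; dec-true)
open import Relation.Unary using (Decidable)
open import Relation.Binary.PropositionalEquality

prime>1 : ∀ {p} → Prime p → 1 < p
prime>1 {p} pp = nonTrivial⇒n>1 p {{prime⇒nonTrivial pp}}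

prime∤1 : ∀ {p} → Prime p → ¬ p ∣ 1
prime∤1 pp p∣1 = <⇒≢ (prime>1 pp) (sym (∣1⇒≡1 p∣1))

prime∣prime : ∀ {p q} → Prime p → Prime q → p ∣ q → p ≡ q
prime∣prime pp pq p∣q with prime⇒irreducible pq p∣q
... | inj₁ p≡1 = contradiction (sym p≡1) (<⇒≢ (prime>1 pp))
... | inj₂ p≡q = p≡q

prime-factor : ∀ n → 1 < n → ∃ λ p → Prime p × p ∣ n
prime-factor n@(suc _) 1<n with factorise n
... | record { factors = [] ; isFactorisation = n≡1 } = contradiction n≡1 (>⇒≢ 1<n)
... | record { factors = p ∷ ps ; isFactorisation = n≡Π ; factorsPrime = pp ∷ _ } =
  p , pp , subst (p ∣_) (sym n≡Π) (m∣m*n (product ps))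

prime*∣ : ∀ {p r c} → Prime p → ¬ p ∣ r → p ∣ c → r ∣ c → p * r ∣ c
prime*∣ {p} {r} pp p∤r p∣c (divides q refl) with euclidsLemma q r pp p∣c
... | inj₁ p∣q = *-monoˡ-∣ r p∣q
... | inj₂ p∣r = contradiction p∣r p∤r

pow∣⇒pow∣*p : ∀ {p} k {z} → p ^ k ∣ z → p ^ suc k ∣ z * p
pow∣⇒pow∣*p {p} k {z} h = subst (_∣ z * p) (*-comm (p ^ k) p) (*-monoˡ-∣ p h)

pow∣*p⇒pow∣ : ∀ {p} k {z} .{{_ : NonZero p}} → p ^ suc k ∣ z * p → p ^ k ∣ z
pow∣*p⇒pow∣ {p} k {z} h = *-cancelʳ-∣ p (subst (_∣ z * p) (*-comm p (p ^ k)) h)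

prime-power-cancel : ∀ {p x} → Prime p → ¬ p ∣ x → ∀ k y → p ^ k ∣ x * y → p ^ k ∣ y
prime-power-cancel pp p∤x zero y _ = 1∣ y
prime-power-cancel {p} {x} pp p∤x (suc k) y pᵏ⁺¹∣xy
  with euclidsLemma x y pp (m*n∣⇒m∣ p (p ^ k) pᵏ⁺¹∣xy)
... | inj₁ p∣x = contradiction p∣x p∤x
... | inj₂ (divides y′ refl) =
  pow∣⇒pow∣*p k (prime-power-cancel pp p∤x k y′
    (pow∣*p⇒pow∣ k {{prime⇒nonZero pp}} (subst (p ^ suc k ∣_) (sym (*-assoc x y′ p)) pᵏ⁺¹∣xy)))

lcm∣* : ∀ x y → lcm x y ∣ x * y
lcm∣* x y = lcm-least (m∣m*n {x} y) (n∣m*n x)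

prime-power-lcm : ∀ {p} → Prime p → ∀ k x y → p ^ k ∣ lcm x y → p ^ k ∣ x ⊎ p ^ k ∣ y
prime-power-lcm pp zero x y _ = inj₁ (1∣ x)
prime-power-lcm {p} pp (suc k) x y pᵏ∣lcm with p ∣? x | p ∣? y
... | no p∤x | _ = inj₂ (prime-power-cancel pp p∤x (suc k) y (∣-trans pᵏ∣lcm (lcm∣* x y)))
... | yes _ | no p∤y = inj₁ (prime-power-cancel pp p∤y (suc k) x
                         (∣-trans pᵏ∣lcm (subst (lcm x y ∣_) (*-comm x y) (lcm∣* x y))))
... | yes (divides x′ refl) | yes (divides y′ refl) =
  Data.Sum.map (pow∣⇒pow∣*p k) (pow∣⇒pow∣*p k)
    (prime-power-lcm pp k x′ y′ (pow∣*p⇒pow∣ k {{prime⇒nonZero pp}} (∣-trans pᵏ∣lcm lcm-scale)))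
  where
  lcm-scale : lcm (x′ * p) (y′ * p) ∣ lcm x′ y′ * p
  lcm-scale = lcm-least (*-monoˡ-∣ p (m∣lcm[m,n] x′ y′)) (*-monoˡ-∣ p (n∣lcm[m,n] x′ y′))

SeparatingPower : ℕ → ℕ → Set
SeparatingPower a b = ∃₂ λ p k → Prime p × p ^ suc k ∣ a × ¬ p ^ suc k ∣ b

-- Conversely every a ∤ b has such a witness; induction on the prime
-- factors of a, peeling one prime off both a and b.
separating-power-∏ : ∀ ps → All Prime ps → ∀ b → ¬ product ps ∣ b → SeparatingPower (product ps) b
separating-power-∏ [] [] b 1∤b = contradiction (1∣ b) 1∤b
separating-power-∏ (p ∷ ps) (pp ∷ pps) b Π∤b with p ∣? b
... | no p∤b = p , 0 , pp , subst (_∣ p * product ps) (sym (*-identityʳ p)) (m∣m*n (product ps)) ,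
               p∤b ∘ subst (_∣ b) (*-identityʳ p)
... | yes (divides b′ refl)
  with separating-power-∏ ps pps b′ (Π∤b ∘ subst (p * product ps ∣_) (*-comm p b′) ∘ *-monoʳ-∣ p)
...   | q , k , pq , qᵏ∣Π , qᵏ∤b′ with q ≟ p
...     | yes refl = q , suc k , pq , *-monoʳ-∣ q qᵏ∣Π ,
                     qᵏ∤b′ ∘ pow∣*p⇒pow∣ (suc k) {{prime⇒nonZero pq}}
...     | no q≢p = q , k , pq , ∣n⇒∣m*n p qᵏ∣Π ,
                   qᵏ∤b′ ∘ prime-power-cancel pq (q≢p ∘ prime∣prime pq pp) (suc k) b′
                         ∘ subst (q ^ suc k ∣_) (*-comm b′ p)

separating-power : ∀ a .{{_ : NonZero a}} b → ¬ a ∣ b → SeparatingPower a b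
separating-power a b a∤b = subst (λ n → SeparatingPower n b) (sym a≡Π)
  (separating-power-∏ factors factorsPrime b (a∤b ∘ subst (_∣ b) (sym a≡Π)))
  where open PrimeFactorisation (factorise a) renaming (isFactorisation to a≡Π)

count-map-≤ : ∀ {A B : Set} {P : B → Set} {Q : A → Set} (P? : Decidable P) (Q? : Decidable Q)
              (f : A → B) → (∀ {a} → P (f a) → Q a) →
              ∀ xs → length (filter P? (map f xs)) ≤ length (filter Q? xs)
count-map-≤ P? Q? f reflects [] = z≤n
count-map-≤ P? Q? f reflects (x ∷ xs) with P? (f x) | Q? x
... | yes _  | yes _  = s≤s (count-map-≤ P? Q? f reflects xs)
... | yes Pfx | no ¬Qx = contradiction (reflects Pfx) ¬Qx
... | no _   | yes _  = m≤n⇒m≤1+n (count-map-≤ P? Q? f reflects xs)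
... | no _   | no _   = count-map-≤ P? Q? f reflects xs

majority-pullback : ∀ {A B : Set} {P : B → Set} {Q : A → Set} (P? : Decidable P) (Q? : Decidable Q)
                    (f : A → B) → (∀ {a} → P (f a) → Q a) → ∀ xs →
                    length (map f xs) ≤ 2 * length (filter P? (map f xs)) →
                    length xs ≤ 2 * length (filter Q? xs)
majority-pullback P? Q? f reflects xs half = begin
  length xs                           ≡⟨ length-map f xs ⟨
  length (map f xs)                   ≤⟨ half ⟩
  2 * length (filter P? (map f xs))   ≤⟨ *-monoʳ-≤ 2 (count-map-≤ P? Q? f reflects xs) ⟩
  2 * length (filter Q? xs)           ∎
  where open ≤-Reasoning

majority-witness : ∀ {A : Set} {P : A → Set} (P? : Decidable P) {x₀} xs → x₀ ∈ xs →
                   length xs ≤ 2 * length (filter P? xs) → ∃ λ x → x ∈ xs × P x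
majority-witness P? xs@(_ ∷ _) _ half with filter P? xs | (λ {v} → ∈-filter⁻ P? {v} {xs})
... | []    | _ = contradiction half λ ()
... | y ∷ _ | ∈filter⇒ = y , ∈filter⇒ (here refl)

-- A map injective on the members of a duplicate-free list keeps it
-- duplicate-free (the library version asks for injectivity everywhere).
unique-map : ∀ {A B : Set} (f : A → B) xs → (∀ {a b} → a ∈ xs → b ∈ xs → f a ≡ f b → a ≡ b) →
             Unique xs → Unique (map f xs)
unique-map f [] injective [] = []
unique-map f (x ∷ xs) injective (x∉xs ∷ unique) =
  distinct xs x∉xs (λ y∈ → y∈) ∷ unique-map f xs (λ a∈ b∈ → injective (there a∈) (there b∈)) unique
  where
  distinct : ∀ ys → All (x ≢_) ys → (∀ {y} → y ∈ ys → y ∈ xs) → All (f x ≢_) (map f ys)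
  distinct [] [] _ = []
  distinct (y ∷ ys) (x≢y ∷ x∉ys) ys⊆xs =
    x≢y ∘ injective (here refl) (there (ys⊆xs (here refl))) ∷ distinct ys x∉ys (ys⊆xs ∘ there)

∈⇒≤sum : ∀ {x} xs → x ∈ xs → x ≤ sum xs
∈⇒≤sum (y ∷ ys) (here refl) = m≤m+n y (sum ys)
∈⇒≤sum (y ∷ ys) (there x∈) = ≤-trans (∈⇒≤sum ys x∈) (m≤n+m (sum ys) y)

decSubset : ∀ {n} {P : Fin n → Set} → Decidable P → Subset n
decSubset P? = tabulate (does ∘ P?)

∈decSubset⁻ : ∀ {n} {P : Fin n → Set} (P? : Decidable P) {x} → x Sub.∈ decSubset P? → P x
∈decSubset⁻ P? {x} x∈ with P? x | trans (sym (lookup∘tabulate (does ∘ P?) x)) ([]=⇒lookup x∈)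
... | yes Px | _ = Px
... | no _   | ()

∈decSubset⁺ : ∀ {n} {P : Fin n → Set} (P? : Decidable P) {x} → P x → x Sub.∈ decSubset P?
∈decSubset⁺ P? {x} Px = lookup⇒[]= x _ (trans (lookup∘tabulate (does ∘ P?) x) (dec-true (P? x) Px))

-- (A) ⇒ (B): encoding subsets of Fin n as squarefree numbers.

∏ : ∀ {n} → Vec ℕ n → ℕ
∏ [] = 1
∏ (p ∷ ps) = p * ∏ ps

-- Primes p₀, …, pₙ₋₁ none of which divides the product of the later ones
-- (equivalently: pairwise distinct primes).
DistinctPrimes : ∀ {n} → Vec ℕ n → Set
DistinctPrimes [] = ⊤
DistinctPrimes (p ∷ ps) = Prime p × ¬ p ∣ ∏ ps × DistinctPrimes ps

∏-positive : ∀ {n} (ps : Vec ℕ n) → DistinctPrimes ps → 0 < ∏ ps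
∏-positive [] _ = s≤s z≤n
∏-positive (p ∷ ps) (pp , _ , distinct) = *-mono-< (<-trans (s≤s z≤n) (prime>1 pp)) (∏-positive ps distinct)

-- Euclid: a prime factor of 1 + ∏ ps divides no entry of ps.
distinct-primes : ∀ n → Σ (Vec ℕ n) DistinctPrimes
distinct-primes zero = [] , tt
distinct-primes (suc n) with distinct-primes n
... | ps , distinct with prime-factor (∏ ps + 1) (+-monoˡ-≤ 1 (∏-positive ps distinct))
... | p , pp , p∣∏+1 = p ∷ ps , pp , (prime∤1 pp ∘ ∣m+n∣m⇒∣n p∣∏+1) , distinct

lookup-prime : ∀ {n} (ps : Vec ℕ n) → DistinctPrimes ps → ∀ i → Prime (lookup ps i)
lookup-prime (p ∷ ps) (pp , _) zero = pp
lookup-prime (p ∷ ps) (_ , _ , distinct) (suc i) = lookup-prime ps distinct i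

lookup∣∏ : ∀ {n} (ps : Vec ℕ n) i → lookup ps i ∣ ∏ ps
lookup∣∏ (p ∷ ps) zero = m∣m*n (∏ ps)
lookup∣∏ (p ∷ ps) (suc i) = ∣n⇒∣m*n p (lookup∣∏ ps i)

lookup-injective : ∀ {n} (ps : Vec ℕ n) → DistinctPrimes ps → ∀ i j → lookup ps i ≡ lookup ps j → i ≡ j
lookup-injective (p ∷ ps) _ zero zero _ = refl
lookup-injective (p ∷ ps) (_ , p∤∏ , _) zero (suc j) p≡pⱼ =
  contradiction (subst (_∣ ∏ ps) (sym p≡pⱼ) (lookup∣∏ ps j)) p∤∏
lookup-injective (p ∷ ps) (_ , p∤∏ , _) (suc i) zero pᵢ≡p =
  contradiction (subst (_∣ ∏ ps) pᵢ≡p (lookup∣∏ ps i)) p∤∏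
lookup-injective (p ∷ ps) (_ , _ , distinct) (suc i) (suc j) pᵢ≡pⱼ =
  cong suc (lookup-injective ps distinct i j pᵢ≡pⱼ)

encode : ∀ {n} → Vec ℕ n → Subset n → ℕ
encode [] [] = 1
encode (p ∷ ps) (true ∷ A) = p * encode ps A
encode (p ∷ ps) (false ∷ A) = encode ps A

encode-mono : ∀ {n} (ps : Vec ℕ n) {A B} → A ⊆ B → encode ps A ∣ encode ps B
encode-mono [] {[]} {[]} _ = ∣-refl
encode-mono (p ∷ ps) {true ∷ A} {true ∷ B} A⊆B = *-monoʳ-∣ p (encode-mono ps (drop-∷-⊆ A⊆B))
encode-mono (p ∷ ps) {true ∷ A} {false ∷ B} A⊆B with A⊆B here
... | ()
encode-mono (p ∷ ps) {false ∷ A} {true ∷ B} A⊆B = ∣n⇒∣m*n p (encode-mono ps (drop-∷-⊆ A⊆B))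
encode-mono (p ∷ ps) {false ∷ A} {false ∷ B} A⊆B = encode-mono ps (drop-∷-⊆ A⊆B)

encode∣∏ : ∀ {n} (ps : Vec ℕ n) A → encode ps A ∣ ∏ ps
encode∣∏ [] [] = ∣-refl
encode∣∏ (p ∷ ps) (true ∷ A) = *-monoʳ-∣ p (encode∣∏ ps A)
encode∣∏ (p ∷ ps) (false ∷ A) = ∣n⇒∣m*n p (encode∣∏ ps A)

encode-positive : ∀ {n} (ps : Vec ℕ n) → DistinctPrimes ps → ∀ A → 1 ≤ encode ps A
encode-positive ps distinct A =
  n≢0⇒n>0 λ code≡0 →
    >⇒≢ (∏-positive ps distinct) (0∣⇒≡0 (subst (_∣ ∏ ps) code≡0 (encode∣∏ ps A)))

∈⇒∣encode : ∀ {n} (ps : Vec ℕ n) {A i} → i Sub.∈ A → lookup ps i ∣ encode ps A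
∈⇒∣encode (p ∷ ps) {true ∷ A} here = m∣m*n (encode ps A)
∈⇒∣encode (p ∷ ps) {true ∷ A} (there i∈A) = ∣n⇒∣m*n p (∈⇒∣encode ps i∈A)
∈⇒∣encode (p ∷ ps) {false ∷ A} (there i∈A) = ∈⇒∣encode ps i∈A

encode-prime-factor : ∀ {n} (ps : Vec ℕ n) → DistinctPrimes ps → ∀ A {q} → Prime q → q ∣ encode ps A →
                      ∃ λ i → i Sub.∈ A × q ≡ lookup ps i
encode-prime-factor [] _ [] pq q∣1 = contradiction q∣1 (prime∤1 pq)
encode-prime-factor (p ∷ ps) (pp , _ , distinct) (true ∷ A) pq q∣code
  with euclidsLemma p (encode ps A) pq q∣code
... | inj₁ q∣p = zero , here , prime∣prime pq pp q∣p
... | inj₂ q∣rest with encode-prime-factor ps distinct A pq q∣rest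
...   | i , i∈A , q≡pᵢ = suc i , there i∈A , q≡pᵢ
encode-prime-factor (p ∷ ps) (_ , _ , distinct) (false ∷ A) pq q∣code
  with encode-prime-factor ps distinct A pq q∣code
... | i , i∈A , q≡pᵢ = suc i , there i∈A , q≡pᵢ

∣encode⇒∈ : ∀ {n} (ps : Vec ℕ n) → DistinctPrimes ps → ∀ A i → lookup ps i ∣ encode ps A → i Sub.∈ A
∣encode⇒∈ ps distinct A i pᵢ∣code
  with encode-prime-factor ps distinct A (lookup-prime ps distinct i) pᵢ∣code
... | j , j∈A , pᵢ≡pⱼ = subst (Sub._∈ A) (sym (lookup-injective ps distinct i j pᵢ≡pⱼ)) j∈A

encode-least : ∀ {n} (ps : Vec ℕ n) → DistinctPrimes ps → ∀ A {c} →
               (∀ {i} → i Sub.∈ A → lookup ps i ∣ c) → encode ps A ∣ c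
encode-least [] _ [] _ = 1∣ _
encode-least (p ∷ ps) (pp , p∤∏ , distinct) (true ∷ A) each∣c =
  prime*∣ pp (λ p∣code → p∤∏ (∣-trans p∣code (encode∣∏ ps A)))
    (each∣c here) (encode-least ps distinct A (each∣c ∘ there))
encode-least (p ∷ ps) (_ , _ , distinct) (false ∷ A) each∣c =
  encode-least ps distinct A (each∣c ∘ there)

encode-lcm : ∀ {n} (ps : Vec ℕ n) → DistinctPrimes ps → ∀ A B →
             lcm (encode ps A) (encode ps B) ≡ encode ps (A ∪ B)
encode-lcm ps distinct A B = ∣-antisym
  (lcm-least (encode-mono ps (p⊆p∪q B)) (encode-mono ps (q⊆p∪q A B)))
  (encode-least ps distinct (A ∪ B) λ {i} i∈A∪B → case-∪ (x∈p∪q⁻ A B i∈A∪B))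
  where
  case-∪ : ∀ {i} → i Sub.∈ A ⊎ i Sub.∈ B → lookup ps i ∣ lcm (encode ps A) (encode ps B)
  case-∪ (inj₁ i∈A) = ∣-trans (∈⇒∣encode ps i∈A) (m∣lcm[m,n] _ _)
  case-∪ (inj₂ i∈B) = ∣-trans (∈⇒∣encode ps i∈B) (n∣lcm[m,n] (encode ps A) _)

-- A code determines its set: its prime factors are the pᵢ with i ∈ A.
encode-injective : ∀ {n} (ps : Vec ℕ n) → DistinctPrimes ps → ∀ {A B} → encode ps A ≡ encode ps B → A ≡ B
encode-injective ps distinct {A} {B} A≡B = ⊆-antisym (included A≡B) (included (sym A≡B))
  where
  included : ∀ {X Y} → encode ps X ≡ encode ps Y → X ⊆ Y
  included {X} {Y} X≡Y {i} i∈X = ∣encode⇒∈ ps distinct Y i (subst (_ ∣_) X≡Y (∈⇒∣encode ps i∈X))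

-- Apply (A) to N = code[S]; a prime factor pᵢ of the frequent divisor d
-- gives the frequent element i, since d ∣ code of C forces i ∈ C.
A⇒B : StatementA → StatementB
A⇒B statementA n S uniqueS closedS (A₀ , A₀∈S , i₀ , i₀∈A₀) =
  frequent-element (statementA N uniqueN positiveN closedN nontrivialN)
  where
  ps = proj₁ (distinct-primes n)
  distinct = proj₂ (distinct-primes n)
  code = encode ps
  N = map code S

  uniqueN : Unique N
  uniqueN = Unique.map⁺ (encode-injective ps distinct) uniqueS

  positiveN : All (1 ≤_) N
  positiveN = All.map⁺ (All.universal (encode-positive ps distinct) S)

  closedN : LCMClosed N
  closedN a∈N b∈N with ∈-map⁻ code a∈N | ∈-map⁻ code b∈N
  ... | A , A∈S , refl | B , B∈S , refl =
    subst (_∈ N) (sym (encode-lcm ps distinct A B)) (∈-map⁺ code (closedS A∈S B∈S))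

  nontrivialN : ∃ λ m → m ∈ N × m ≢ 1
  nontrivialN = code A₀ , ∈-map⁺ code A₀∈S ,
    λ code≡1 → prime∤1 (lookup-prime ps distinct i₀) (subst (_ ∣_) code≡1 (∈⇒∣encode ps i₀∈A₀))

  frequent-element : (∃ λ d → 1 < d × length N ≤ 2 * countDiv d N) →
                     ∃ λ x → InUnion x S × length S ≤ 2 * countMem x S
  frequent-element (d , 1<d , half) with majority-witness (d ∣?_) N (∈-map⁺ code A₀∈S) half
  ... | _ , m∈N , d∣m with ∈-map⁻ code m∈N | prime-factor d 1<d
  ... | B , B∈S , refl | q , pq , q∣d with encode-prime-factor ps distinct B pq (∣-trans q∣d d∣m)
  ... | i , i∈B , refl = i , (B , B∈S , i∈B) ,
    majority-pullback (d ∣?_) (i ∈?_) code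
      (λ {C} d∣code → ∣encode⇒∈ ps distinct C i (∣-trans q∣d d∣code)) S half

-- (B) ⇒ (A): encoding the members of N as sets of "N-primes".

module NPrimeEncoding (N : List ℕ) where

  -- Every member of N, hence every divisor of one, is at most M.
  M : ℕ
  M = sum N

  -- q behaves like a prime with respect to lcm's of members of N.  Only
  -- members of N are quantified over, which keeps the notion decidable.
  NPrime : ℕ → Set
  NPrime q = 1 < q × All (λ x → All (λ y → q ∣ lcm x y → q ∣ x ⊎ q ∣ y) N) N

  nprime? : Decidable NPrime
  nprime? q = (1 <? q) ×-dec
    all? (λ x → all? (λ y → q ∣? lcm x y →-dec (q ∣? x ⊎-dec q ∣? y)) N) N

  prime-power-nprime : ∀ {p} → Prime p → ∀ k → NPrime (p ^ suc k)
  prime-power-nprime {p} pp k =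
    *-mono-≤ (prime>1 pp) (m^n>0 p {{prime⇒nonZero pp}} k) ,
    All.tabulate λ {x} _ → All.tabulate λ {y} _ → prime-power-lcm pp (suc k) x y

  prime-nprime : ∀ {p} → Prime p → NPrime p
  prime-nprime {p} pp = subst NPrime (*-identityʳ p) (prime-power-nprime pp 0)

  recorded? : ∀ m → Decidable (λ (x : Fin (suc M)) → NPrime (toℕ x) × toℕ x ∣ m)
  recorded? m x = nprime? (toℕ x) ×-dec (toℕ x ∣? m)

  φ : ℕ → Subset (suc M)
  φ m = decSubset (recorded? m)

  ∈φ⁻ : ∀ m {x} → x Sub.∈ φ m → NPrime (toℕ x) × toℕ x ∣ m
  ∈φ⁻ m = ∈decSubset⁻ (recorded? m)

  ∈φ⁺ : ∀ m {x} → NPrime (toℕ x) → toℕ x ∣ m → x Sub.∈ φ m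
  ∈φ⁺ m nprime x∣m = ∈decSubset⁺ (recorded? m) (nprime , x∣m)

  slot : ∀ {q} → q ≤ M → Fin (suc M)
  slot q≤M = fromℕ< (s≤s q≤M)

  toℕ-slot : ∀ {q} (q≤M : q ≤ M) → toℕ (slot q≤M) ≡ q
  toℕ-slot q≤M = toℕ-fromℕ< (s≤s q≤M)

  slot∈φ : ∀ m {q} (q≤M : q ≤ M) → NPrime q → q ∣ m → slot q≤M Sub.∈ φ m
  slot∈φ m q≤M nprime q∣m =
    ∈φ⁺ m (subst NPrime (sym (toℕ-slot q≤M)) nprime) (subst (_∣ m) (sym (toℕ-slot q≤M)) q∣m)

  divisor≤M : All (1 ≤_) N → ∀ {q a} → a ∈ N → q ∣ a → q ≤ M
  divisor≤M positive a∈N q∣a =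
    ≤-trans (∣⇒≤ {{>-nonZero (All.lookup positive a∈N)}} q∣a) (∈⇒≤sum N a∈N)

  φ-lcm : ∀ {a b} → a ∈ N → b ∈ N → φ (lcm a b) ≡ φ a ∪ φ b
  φ-lcm {a} {b} a∈N b∈N = ⊆-antisym split join
    where
    split : φ (lcm a b) ⊆ φ a ∪ φ b
    split x∈ with ∈φ⁻ (lcm a b) x∈
    ... | nprime@(_ , lcm-prime) , x∣lcm = x∈p∪q⁺
      (Data.Sum.map (∈φ⁺ a nprime) (∈φ⁺ b nprime)
        (All.lookup (All.lookup lcm-prime a∈N) b∈N x∣lcm))

    join : φ a ∪ φ b ⊆ φ (lcm a b)
    join x∈ with x∈p∪q⁻ (φ a) (φ b) x∈
    ... | inj₁ x∈φa = let nprime , x∣a = ∈φ⁻ a x∈φa in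
                      ∈φ⁺ (lcm a b) nprime (∣-trans x∣a (m∣lcm[m,n] a b))
    ... | inj₂ x∈φb = let nprime , x∣b = ∈φ⁻ b x∈φb in
                      ∈φ⁺ (lcm a b) nprime (∣-trans x∣b (n∣lcm[m,n] a b))

  -- φ reflects divisibility on N: a prime power separating a from b would
  -- be an N-prime in φ a but not in φ b.
  φ-reflects-∣ : All (1 ≤_) N → ∀ {a b} → a ∈ N → φ a ⊆ φ b → a ∣ b
  φ-reflects-∣ positive {a} {b} a∈N φa⊆φb with a ∣? b
  ... | yes a∣b = a∣b
  ... | no a∤b with separating-power a {{>-nonZero (All.lookup positive a∈N)}} b a∤b
  ... | p , k , pp , pᵏ∣a , pᵏ∤b = contradiction pᵏ∣b pᵏ∤b
    where
    q≤M = divisor≤M positive a∈N pᵏ∣a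
    q∈φa : slot q≤M Sub.∈ φ a
    q∈φa = slot∈φ a q≤M (prime-power-nprime pp k) pᵏ∣a
    pᵏ∣b : p ^ suc k ∣ b
    pᵏ∣b = subst (_∣ b) (toℕ-slot q≤M) (proj₂ (∈φ⁻ b (φa⊆φb q∈φa)))

  φ-injective : All (1 ≤_) N → ∀ {a b} → a ∈ N → b ∈ N → φ a ≡ φ b → a ≡ b
  φ-injective positive a∈N b∈N φa≡φb =
    ∣-antisym (φ-reflects-∣ positive a∈N (⊆-reflexive φa≡φb))
              (φ-reflects-∣ positive b∈N (⊆-reflexive (sym φa≡φb)))

  frequent-divisor : StatementB → Unique N → All (1 ≤_) N → LCMClosed N →
                     (∃ λ n → n ∈ N × n ≢ 1) → ∃ λ d → 1 < d × length N ≤ 2 * countDiv d N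
  frequent-divisor statementB uniqueN positive closedN (n₀ , n₀∈N , n₀≢1) =
    frequent-divisor-of (statementB (suc M) S uniqueS closedS nonemptyS)
    where
    S = map φ N

    uniqueS : Unique S
    uniqueS = unique-map φ N (φ-injective positive) uniqueN

    closedS : UnionClosed S
    closedS A∈S B∈S with ∈-map⁻ φ A∈S | ∈-map⁻ φ B∈S
    ... | a , a∈N , refl | b , b∈N , refl =
      subst (_∈ S) (φ-lcm a∈N b∈N) (∈-map⁺ φ (closedN a∈N b∈N))

    -- A prime factor p of n₀ ≠ 1 is an N-prime, so φ n₀ is nonempty.
    nonemptyS : ∃ λ A → A ∈ S × Sub.Nonempty A
    nonemptyS with prime-factor n₀ (≤∧≢⇒< (All.lookup positive n₀∈N) (n₀≢1 ∘ sym))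
    ... | p , pp , p∣n₀ =
      φ n₀ , ∈-map⁺ φ n₀∈N , slot p≤M , slot∈φ n₀ p≤M (prime-nprime pp) p∣n₀
      where p≤M = divisor≤M positive n₀∈N p∣n₀

    -- The frequent element x is an N-prime, and x ∈ φ a implies x ∣ a.
    frequent-divisor-of : (∃ λ x → InUnion x S × length S ≤ 2 * countMem x S) →
                          ∃ λ d → 1 < d × length N ≤ 2 * countDiv d N
    frequent-divisor-of (x , (A , A∈S , x∈A) , half) with ∈-map⁻ φ A∈S
    ... | a , _ , refl = toℕ x , proj₁ (proj₁ (∈φ⁻ a x∈A)) ,
      majority-pullback (x ∈?_) (toℕ x ∣?_) φ (λ {b} → proj₂ ∘ ∈φ⁻ b) N half

B⇒A : StatementB → StatementA
B⇒A statementB N = NPrimeEncoding.frequent-divisor N statementB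

theorem1 : StatementA ⇔ StatementB
theorem1 = mk⇔ A⇒B B⇒A
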